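{- Let $n\geq 1$, let $\Omega$ be a countably infinite set and $A$ a finite subset of $\Omega$. The subspace $V_A$ has finite index in $\mathbb{F}_2^{[\Omega]^{n-1}}$. Moreover, if $V$ is a closed $\operatorname{Sym}(\Omega\setminus A)$-submodule of $\mathbb{F}_2^{[\Omega]^{n-1}}$ of finite index, then $V_A\subseteq V$.
   Context: $[X]^m$ denotes the set of $m$-element subsets of $X$; $\mathbb{F}_2^{[\Omega]^{n-1}}$ is the group of functions $[\Omega]^{n-1}\to\mathbb{F}_2$, with $\operatorname{Sym}(\Omega)$ acting by $f^\sigma(w)=f(w^{\sigma^{ -1}})$, and with the topology of pointwise convergence (as a subgroup of $\operatorname{Sym}([\Omega]^{n-1}\times\mathbb{F}_2)$ via $(w,\delta)^f=(w,f(w)+\delta)$). $\operatorname{Sym}(\Omega\setminus A)$ denotes the pointwise stabilizer of $A$ in $\operatorname{Sym}(\Omega)$; a closed $\operatorname{Sym}(\Omega\setminus A)$-submodule is a closed subgroup invariant under it. For $B\subseteq A$, $V_{B,A}=\{f: f(w)=0\text{ for all }w\in[\Omega]^{n-1}\text{ with }w\cap A\neq B\}$, and $V_A=\bigoplus_{B\subseteq A,\ |B|<n-1}V_{B,A}$. -}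

module Defs where

open import Data.Nat using (ℕ; _∸_; _<_)
open import Data.Bool using (Bool; false; _xor_)
open import Data.List using (List; []; _∷_; length; map)
open import Data.List.Membership.Propositional using (_∈_)
open import Data.List.Relation.Unary.All using (All)
open import Data.List.Relation.Unary.Any using (Any)
open import Data.List.Relation.Unary.Unique.Propositional using (Unique)
open import Data.List.Relation.Binary.Permutation.Propositional using (_↭_)
open import Data.Product using (Σ; _×_; ∃; ∃-syntax; proj₁; proj₂)
open import Function.Bundles using (_↔_; _⇔_; Inverse)
open import Relation.Binary.PropositionalEquality using (_≡_)
open import Relation.Nullary using (¬_)

-- Ω is taken to be ℕ (a fixed countably infinite set).
-- An element w of [Ω]^m is represented by a duplicate-free list of length m.
Valid : ℕ → List ℕ → Set
Valid m w = Unique w × length w ≡ m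

-- Elements of 𝔽₂^{[Ω]^m}: functions on lists (𝔽₂ = Bool, + = xor) that
-- only depend on the underlying set (invariant under reordering).
-- Values on non-valid lists are junk and are never observed.
IsSetFun : ℕ → (List ℕ → Bool) → Set
IsSetFun m f = ∀ xs ys → Valid m xs → xs ↭ ys → f xs ≡ f ys

Fn : Set
Fn = List ℕ → Bool

zeroF : Fn
zeroF _ = false

_⊕_ : Fn → Fn → Fn
(f ⊕ g) w = f w xor g w

sumF : List Fn → Fn
sumF [] = zeroF
sumF (f ∷ fs) = f ⊕ sumF fs

_≈[_]_ : Fn → ℕ → Fn → Set
f ≈[ m ] g = ∀ w → Valid m w → f w ≡ g w

record IsSubgroup (m : ℕ) (V : Fn → Set) : Set where
  field
    inG   : ∀ f → V f → IsSetFun m f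
    zero∈ : V zeroF
    ⊕∈    : ∀ f g → V f → V g → V (f ⊕ g)

-- closed in the topology of pointwise convergence (relative to 𝔽₂^{[Ω]^m}):
-- if every finite set of points admits an element of V agreeing with f there,
-- then f ∈ V.
IsClosed : ℕ → (Fn → Set) → Set
IsClosed m V = ∀ f → IsSetFun m f →
  (∀ (ws : List (List ℕ)) → All (Valid m) ws →
     ∃[ g ] (V g × All (λ w → f w ≡ g w) ws)) → V f

act : (ℕ ↔ ℕ) → Fn → Fn
act σ f w = f (map (Inverse.from σ) w)

FixesPointwise : List ℕ → (ℕ ↔ ℕ) → Set
FixesPointwise A σ = ∀ a → a ∈ A → Inverse.to σ a ≡ a

record IsClosedSubmodule (m : ℕ) (A : List ℕ) (V : Fn → Set) : Set₁ where
  field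
    subgroup  : IsSubgroup m V
    closed    : IsClosed m V
    invariant : ∀ σ → FixesPointwise A σ → ∀ f → V f → V (act σ f)

FiniteIndex : ℕ → (Fn → Set) → Set
FiniteIndex m V = ∃[ reps ] (All (IsSetFun m) reps ×
  (∀ f → IsSetFun m f → Any (λ r → V (f ⊕ r)) reps))

InterIs : List ℕ → List ℕ → List ℕ → Set
InterIs w A B = ∀ x → ((x ∈ w × x ∈ A) ⇔ x ∈ B)

V[_,_]_ : List ℕ → List ℕ → ℕ → Fn → Set
(V[ B , A ] m) f = IsSetFun m f × (∀ w → Valid m w → ¬ InterIs w A B → f w ≡ false)

SmallSubset : ℕ → List ℕ → List ℕ → Set
SmallSubset m A B = Unique B × All (_∈ A) B × length B < m

-- V_A = ⊕_{B ⊆ A, |B| < m} V_{B,A} (internal sum) inside 𝔽₂^{[Ω]^m}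
VA : ℕ → List ℕ → Fn → Set
VA m A f = IsSetFun m f × ∃[ parts ] (
  All (λ p → SmallSubset m A (proj₁ p) ×
             (V[ proj₁ p , A ] m) (proj₂ p)) parts
  × f ≈[ m ] sumF (map proj₂ parts))

-- V_A has finite index: let r_S be the indicator of the m-sets v ⊆ A lying in S. For any f,
-- subtracting r_S with S = {B ⊆ A : f B = 1} kills f on every m-subset of A, and what remains
-- splits, according to the value of w ∩ A, into a sum of elements of the V_{B,A} with |B| < m.
--
-- V_A ⊆ V: an element of V_{B,A} with |B| < m is supported on m-sets w having a point x ∉ A, so by
-- closedness it suffices that V contains the indicator 𝟙_w of every such w. Let y_0, y_1, … be fresh
-- points. By finite index two of the translates 𝟙_{(x y_k) w} lie in a common coset, so
-- 𝟙_{(x y_i) w} + 𝟙_{(x y_j) w} ∈ V; applying (x y_i), which fixes A pointwise, gives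
-- 𝟙_w + 𝟙_{w′} ∈ V with y_j ∈ w′. Since y_j can be chosen outside any finite set of m-sets,
-- 𝟙_w is a limit of elements of V.
module Submission where

open import Defs
open import Data.Bool using (Bool; true; false; _∧_; not; _xor_)
open import Data.Bool.Properties using (∧-zeroʳ; ∧-identityʳ; xor-identityʳ; xor-same) renaming (_≟_ to _≟ᴮ_)
open import Data.Empty using (⊥-elim)
open import Data.Fin using (Fin; toℕ)
open import Data.Fin.Properties using (pigeonhole)
open import Data.List using (List; []; _∷_; [_]; _++_; map; filter; length; concat; lookup; deduplicate)
open import Data.List.Properties using (length-removeAt′; ∷-injectiveʳ; ≡-dec; filter-≐; map-∘; map-cong; map-id)
open import Data.List.Membership.Propositional using (_∈_; _∉_; lose; find)
open import Data.List.Membership.Propositional.Properties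
  using (∈-map⁺; ∈-map⁻; ∈-++⁺ˡ; ∈-++⁺ʳ; ∈-++⁻; ∈-concat⁺′; ∈-filter⁺; ∈-filter⁻; ∈-deduplicate⁺; ∈-deduplicate⁻)
open import Data.List.Membership.Propositional.Properties.WithK using (unique∧set⇒bag)
open import Data.List.Relation.Unary.All as All using (All; []; _∷_)
import Data.List.Relation.Unary.All.Properties as All
open import Data.List.Relation.Unary.Any using (Any; here; there; index; _─_; any?)
open import Data.List.Relation.Unary.Any.Properties as Any using (lookup-index)
open import Data.List.Relation.Unary.Unique.Propositional using (Unique; []; _∷_)
import Data.List.Relation.Unary.Unique.Propositional.Properties as Unique
open import Data.List.Relation.Unary.Unique.DecPropositional.Properties using (deduplicate-!)
open import Data.List.Relation.Binary.Subset.Propositional using (_⊆_)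
open import Data.List.Relation.Binary.BagAndSetEquality using (_∼[_]_; set; bag-=⇒; ↭⇒∼bag; ∼bag⇒↭; [_]-Equality)
import Data.List.Relation.Binary.BagAndSetEquality as BagSet
open import Data.Nat using (ℕ; suc; _+_; _∸_; _≤_; _<_; _≟_; z≤n; s≤s)
open import Data.Nat.Properties using (_<?_; <⇒≢; <⇒≱; ≤-<-trans; ≤-trans; m≤m+n; m≤n+m; n<1+n; +-cancelˡ-≡)
open import Data.Nat.ListAction using (sum)
open import Data.List.Membership.DecPropositional _≟_ using (_∈?_)
open import Data.List.Relation.Binary.Subset.DecPropositional _≟_ using (_⊆?_)
open import Data.Product using (Σ; _×_; _,_; proj₁; proj₂; ∃-syntax)
open import Data.Sum using (_⊎_; inj₁; inj₂; [_,_]′)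
open import Function using (_∘_; case_of_)
open import Function.Bundles using (_↔_; mk↔ₛ′; mk⇔; Equivalence)
open import Relation.Binary.Bundles using (Setoid)
open import Relation.Binary.Definitions using (DecidableEquality)
open import Relation.Binary.PropositionalEquality
  using (_≡_; _≢_; ≢-sym; refl; sym; trans; cong; cong₂; subst; module ≡-Reasoning)
open import Relation.Nullary using (¬_; Dec; yes; no; does)
open import Relation.Nullary.Decidable using (T?; ¬?; map′; _×-dec_; does-⇔; dec-true; dec-false; decidable-stable)
open import Relation.Unary using (Decidable)

private variable
  X : Set
  x y : X
  xs ys B : List X

∈-─⁺ : (x∈xs : x ∈ xs) → y ∈ xs → y ≢ x → y ∈ (xs ─ x∈xs)
∈-─⁺ (here refl) (here refl) y≢x = ⊥-elim (y≢x refl)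
∈-─⁺ (here refl) (there y∈xs) _ = y∈xs
∈-─⁺ (there _) (here refl) _ = here refl
∈-─⁺ (there x∈xs) (there y∈xs) y≢x = there (∈-─⁺ x∈xs y∈xs y≢x)

unique∧⊆⇒length≤ : Unique xs → xs ⊆ ys → length xs ≤ length ys
unique∧⊆⇒length≤ [] _ = z≤n
unique∧⊆⇒length≤ {xs = x ∷ xs} {ys} (x∉xs ∷ xs!) x∷xs⊆ys =
  subst (suc (length xs) ≤_) (sym (length-removeAt′ ys (index x∈ys)))
    (s≤s (unique∧⊆⇒length≤ xs! λ y∈xs →
      ∈-─⁺ x∈ys (x∷xs⊆ys (there y∈xs)) (≢-sym (All.lookup x∉xs y∈xs))))
  where x∈ys = x∷xs⊆ys (here refl)

∈⇒≤sum : {z : ℕ} {zs : List ℕ} → z ∈ zs → z ≤ sum zs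
∈⇒≤sum {zs = z ∷ zs} (here refl) = m≤m+n z (sum zs)
∈⇒≤sum {zs = z′ ∷ zs} (there z∈zs) = ≤-trans (∈⇒≤sum z∈zs) (m≤n+m (sum zs) z′)

map-involutive : {h : X → X} → (∀ z → h (h z) ≡ z) → (xs : List X) → map h (map h xs) ≡ xs
map-involutive h-inv xs = trans (sym (map-∘ xs)) (trans (map-cong h-inv xs) (map-id xs))

subsets : List X → List (List X)
subsets [] = [ [] ]
subsets (x ∷ xs) = map (x ∷_) (subsets xs) ++ subsets xs

filter∈subsets : {P : X → Set} (P? : Decidable P) (xs : List X) → filter P? xs ∈ subsets xs
filter∈subsets P? [] = here refl
filter∈subsets P? (x ∷ xs) with does (P? x)
... | true = ∈-++⁺ˡ (∈-map⁺ (x ∷_) (filter∈subsets P? xs))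
... | false = ∈-++⁺ʳ _ (filter∈subsets P? xs)

∈-subsets⇒⊆ : (xs : List X) → B ∈ subsets xs → B ⊆ xs
∈-subsets⇒⊆ [] (here refl) ()
∈-subsets⇒⊆ (x ∷ xs) B∈ with ∈-++⁻ (map (x ∷_) (subsets xs)) B∈
... | inj₂ B∈′ = there ∘ ∈-subsets⇒⊆ xs B∈′
... | inj₁ B∈′ with ∈-map⁻ (x ∷_) B∈′
...   | B′ , B′∈ , refl = λ { (here refl) → here refl ; (there z∈) → there (∈-subsets⇒⊆ xs B′∈ z∈) }

∈-subsets⇒unique : Unique xs → B ∈ subsets xs → Unique B
∈-subsets⇒unique {xs = []} [] (here refl) = []
∈-subsets⇒unique {xs = x ∷ xs} (x∉xs ∷ xs!) B∈ with ∈-++⁻ (map (x ∷_) (subsets xs)) B∈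
... | inj₂ B∈′ = ∈-subsets⇒unique xs! B∈′
... | inj₁ B∈′ with ∈-map⁻ (x ∷_) B∈′
...   | B′ , B′∈ , refl =
  All.tabulate (All.lookup x∉xs ∘ ∈-subsets⇒⊆ xs B′∈) ∷ ∈-subsets⇒unique xs! B′∈

subsets-unique : Unique xs → Unique (subsets xs)
subsets-unique {xs = []} [] = [] ∷ []
subsets-unique {xs = x ∷ xs} (x∉xs ∷ xs!) =
  Unique.++⁺ (Unique.map⁺ ∷-injectiveʳ (subsets-unique xs!)) (subsets-unique xs!) disjoint
  where
  disjoint : ∀ {B} → ¬ (B ∈ map (x ∷_) (subsets xs) × B ∈ subsets xs)
  disjoint (B∈ , B∈′) with ∈-map⁻ (x ∷_) B∈
  ... | _ , _ , refl = All.lookup x∉xs (∈-subsets⇒⊆ xs B∈′ (here refl)) refl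

xor-not-∧ : ∀ a s r → (s ≡ false → r ≡ a) → a xor (not s ∧ r) ≡ a ∧ s
xor-not-∧ a true r _ = trans (xor-identityʳ a) (sym (∧-identityʳ a))
xor-not-∧ a false r r≡a rewrite r≡a refl = trans (xor-same a) (sym (∧-zeroʳ a))

xor-cancelʳ : ∀ a b r → (a xor r) xor (b xor r) ≡ a xor b
xor-cancelʳ a b false = cong₂ _xor_ (xor-identityʳ a) (xor-identityʳ b)
xor-cancelʳ false false true = refl
xor-cancelʳ false true true = refl
xor-cancelʳ true false true = refl
xor-cancelʳ true true true = refl

disagreement : {a b : Bool} → a ≢ b → (b ≡ true → a ≡ true) → a ≡ true × b ≡ false
disagreement {true} {true} a≢b _ = ⊥-elim (a≢b refl)
disagreement {true} {false} _ _ = refl , refl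
disagreement {false} {true} _ b⇒a = case b⇒a refl of λ ()
disagreement {false} {false} a≢b _ = ⊥-elim (a≢b refl)

xor-true : ∀ a b → a xor b ≡ true → b ≡ true ⊎ a ≡ true
xor-true a true _ = inj₁ refl
xor-true a false a⊕false≡true = inj₂ (trans (sym (xor-identityʳ a)) a⊕false≡true)

parity : List X → (X → Bool) → Bool
parity [] h = false
parity (x ∷ xs) h = h x xor parity xs h

parity-false : (xs : List X) → parity xs (λ _ → false) ≡ false
parity-false [] = refl
parity-false (x ∷ xs) = parity-false xs

parity-∧ˡ : (b : Bool) (xs : List X) (h : X → Bool) → parity xs (λ x → b ∧ h x) ≡ b ∧ parity xs h
parity-∧ˡ true xs h = refl
parity-∧ˡ false xs h = parity-false xs

module _ (_≈?_ : DecidableEquality X) where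
  open import Data.List.Membership.DecPropositional _≈?_ using () renaming (_∈?_ to _∈ₓ?_)

  parity-≟ : Unique xs → parity xs (λ y → does (x ≈? y)) ≡ does (x ∈ₓ? xs)
  parity-≟ [] = refl
  parity-≟ {xs = y ∷ ys} {x} (y∉ys ∷ ys!) with x ≈? y
  ... | no _ = parity-≟ ys!
  ... | yes refl rewrite parity-≟ {x = x} ys! | dec-false (x ∈ₓ? ys) (λ x∈ys → All.lookup y∉ys x∈ys refl) = refl

sumF-map≡parity : (xs : List X) (g : X → Fn) (v : List ℕ) → sumF (map g xs) v ≡ parity xs (λ x → g x v)
sumF-map≡parity [] g v = refl
sumF-map≡parity (x ∷ xs) g v = cong (g x v xor_) (sumF-map≡parity xs g v)

module ∼ₛ = Setoid ([ set ]-Equality ℕ)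

private variable
  m : ℕ
  f g : Fn
  u v w : List ℕ

⊆-antisym⇒∼ₛ : u ⊆ v × v ⊆ u → u ∼[ set ] v
⊆-antisym⇒∼ₛ (u⊆v , v⊆u) = mk⇔ u⊆v v⊆u

_∼ₛ?_ : (u v : List ℕ) → Dec (u ∼[ set ] v)
u ∼ₛ? v = map′ ⊆-antisym⇒∼ₛ (λ u∼v → Equivalence.to u∼v , Equivalence.from u∼v)
               (u ⊆? v ×-dec v ⊆? u)

𝟙[_] : List ℕ → Fn
𝟙[ w ] v = does (v ∼ₛ? w)

SetInvariant : Fn → Set
SetInvariant g = ∀ {u v} → u ∼[ set ] v → g u ≡ g v

SetInvariant⇒IsSetFun : SetInvariant g → IsSetFun m g
SetInvariant⇒IsSetFun g-inv _ _ _ u↭v = g-inv (bag-=⇒ (↭⇒∼bag u↭v))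

IsSetFun-resp-∼ₛ : IsSetFun m f → Valid m u → Unique v → u ∼[ set ] v → f u ≡ f v
IsSetFun-resp-∼ₛ f-set u-valid v! u∼v =
  f-set _ _ u-valid (∼bag⇒↭ (unique∧set⇒bag (proj₁ u-valid) v! u∼v))

𝟙-invariant : (w : List ℕ) → SetInvariant 𝟙[ w ]
𝟙-invariant w u∼v = does-⇔ (mk⇔ (∼ₛ.trans (∼ₛ.sym u∼v)) (∼ₛ.trans u∼v)) (_ ∼ₛ? w) (_ ∼ₛ? w)

𝟙-self : (w : List ℕ) → 𝟙[ w ] w ≡ true
𝟙-self w = dec-true (w ∼ₛ? w) ∼ₛ.refl

𝟙-separated : y ∈ w → y ∉ v → 𝟙[ w ] v ≡ false
𝟙-separated {w = w} {v} y∈w y∉v = dec-false (v ∼ₛ? w) (λ v∼w → y∉v (Equivalence.from v∼w y∈w))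

𝟙-true⇒∼ₛ : 𝟙[ w ] v ≡ true → v ∼[ set ] w
𝟙-true⇒∼ₛ {w} {v} eq =
  decidable-stable (v ∼ₛ? w) (λ v≁w → case trans (sym eq) (dec-false (v ∼ₛ? w) v≁w) of λ ())

IsSetFun-⊕ : IsSetFun m f → IsSetFun m g → IsSetFun m (f ⊕ g)
IsSetFun-⊕ f-set g-set xs ys xs-valid xs↭ys =
  cong₂ _xor_ (f-set xs ys xs-valid xs↭ys) (g-set xs ys xs-valid xs↭ys)

𝟙-IsSetFun : (w : List ℕ) → IsSetFun m 𝟙[ w ]
𝟙-IsSetFun w = SetInvariant⇒IsSetFun (𝟙-invariant w)

map-involution-∼ₛ : {h : ℕ → ℕ} → (∀ z → h (h z) ≡ z) → map h u ∼[ set ] w → u ∼[ set ] map h w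
map-involution-∼ₛ {u = u} h-inv hu∼w =
  subst (_∼[ set ] _) (map-involutive h-inv u) (BagSet.map-cong (λ _ → refl) hu∼w)

𝟙-map-involution : {h : ℕ → ℕ} → (∀ z → h (h z) ≡ z) → (w v : List ℕ) → 𝟙[ w ] (map h v) ≡ 𝟙[ map h w ] v
𝟙-map-involution {h} h-inv w v = does-⇔ (mk⇔ (map-involution-∼ₛ h-inv) from) (map h v ∼ₛ? w) (v ∼ₛ? map h w)
  where
  from : v ∼[ set ] map h w → map h v ∼[ set ] w
  from v∼hw = ∼ₛ.sym (map-involution-∼ₛ h-inv (∼ₛ.sym v∼hw))

module FiniteIndexOfVA (m : ℕ) (A : List ℕ) where
  open import Data.List.Membership.DecPropositional (≡-dec _≟_) using () renaming (_∈?_ to _∈ᴸ?_)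

  _≟ᴸ_ : DecidableEquality (List ℕ)
  _≟ᴸ_ = ≡-dec _≟_

  A! : List ℕ
  A! = deduplicate _≟_ A

  -- v ∩ A, listed in the order of A!, so that set-equal v have equal traces.
  trace : List ℕ → List ℕ
  trace v = filter (_∈? v) A!

  trace-unique : (v : List ℕ) → Unique (trace v)
  trace-unique v = Unique.filter⁺ (_∈? v) (deduplicate-! _≟_ A)

  trace-⊆ : (v : List ℕ) → trace v ⊆ v
  trace-⊆ v = proj₂ ∘ ∈-filter⁻ (_∈? v) {xs = A!}

  trace-InterIs : (v : List ℕ) → InterIs v A (trace v)
  trace-InterIs v z = mk⇔ (λ (z∈v , z∈A) → ∈-filter⁺ (_∈? v) (∈-deduplicate⁺ _≟_ z∈A) z∈v)
                          (λ z∈t → trace-⊆ v z∈t , ∈-deduplicate⁻ _≟_ A (proj₁ (∈-filter⁻ (_∈? v) z∈t)))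

  trace-cong : u ∼[ set ] v → trace u ≡ trace v
  trace-cong {u} {v} u∼v = filter-≐ (_∈? u) (_∈? v) (Equivalence.to u∼v , Equivalence.from u∼v) A!

  trace∈subsets : (v : List ℕ) → trace v ∈ subsets A!
  trace∈subsets v = filter∈subsets (_∈? v) A!

  trace-large⇒∼ₛ : Valid m v → ¬ length (trace v) < m → v ∼[ set ] trace v
  trace-large⇒∼ₛ {v} (v! , |v|≡m) large = ⊆-antisym⇒∼ₛ (v⊆t , trace-⊆ v)
    where
    v⊆t : v ⊆ trace v
    v⊆t {z} z∈v = decidable-stable (z ∈? trace v) λ z∉t →
      large (subst (suc (length (trace v)) ≤_) |v|≡m
        (unique∧⊆⇒length≤ (All.tabulate (λ y∈t z≡y → z∉t (subst (_∈ trace v) (sym z≡y) y∈t)) ∷ trace-unique v)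
                          λ { (here refl) → z∈v ; (there y∈t) → trace-⊆ v y∈t }))

  small? : (B : List ℕ) → Dec (length B < m)
  small? B = length B <? m

  -- On an m-set v, a trace of length ≥ m means v ⊆ A (see trace-large⇒∼ₛ).
  representative : List (List ℕ) → Fn
  representative S v = not (does (small? (trace v))) ∧ does (trace v ∈ᴸ? S)

  representative-invariant : (S : List (List ℕ)) → SetInvariant (representative S)
  representative-invariant S u∼v = cong (λ t → not (does (small? t)) ∧ does (t ∈ᴸ? S)) (trace-cong u∼v)

  support : Fn → List (List ℕ)
  support f = filter (T? ∘ f) (subsets A!)

  trace∈support : (f : Fn) (v : List ℕ) → does (trace v ∈ᴸ? support f) ≡ f (trace v)
  trace∈support f v =
    does-⇔ (mk⇔ (proj₂ ∘ ∈-filter⁻ (T? ∘ f) {xs = subsets A!}) (∈-filter⁺ (T? ∘ f) (trace∈subsets v)))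
           (trace v ∈ᴸ? support f) (T? (f (trace v)))

  smallSubsets : List (List ℕ)
  smallSubsets = filter small? (subsets A!)

  smallSubsets-unique : Unique smallSubsets
  smallSubsets-unique = Unique.filter⁺ small? (subsets-unique (deduplicate-! _≟_ A))

  ∈-smallSubsets⇒SmallSubset : B ∈ smallSubsets → SmallSubset m A B
  ∈-smallSubsets⇒SmallSubset B∈ =
    ∈-subsets⇒unique (deduplicate-! _≟_ A) B∈subsets ,
    All.tabulate (∈-deduplicate⁻ _≟_ A ∘ ∈-subsets⇒⊆ A! B∈subsets) ,
    B-small
    where
    B∈subsets = proj₁ (∈-filter⁻ small? {xs = subsets A!} B∈)
    B-small = proj₂ (∈-filter⁻ small? {xs = subsets A!} B∈)

  trace∈smallSubsets : (v : List ℕ) → does (trace v ∈ᴸ? smallSubsets) ≡ does (small? (trace v))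
  trace∈smallSubsets v =
    does-⇔ (mk⇔ (proj₂ ∘ ∈-filter⁻ small? {xs = subsets A!}) (∈-filter⁺ small? (trace∈subsets v)))
           (trace v ∈ᴸ? smallSubsets) (small? (trace v))

  piece : Fn → List ℕ → Fn
  piece f B v = f v ∧ does (trace v ≟ᴸ B)

  piece∈V[B,A] : IsSetFun m f → (V[ B , A ] m) (piece f B)
  piece∈V[B,A] {f} {B} f-set = piece-set , piece-vanishes
    where
    piece-set : IsSetFun m (piece f B)
    piece-set xs ys xs-valid xs↭ys =
      cong₂ _∧_ (f-set xs ys xs-valid xs↭ys) (cong (λ t → does (t ≟ᴸ B)) (trace-cong (bag-=⇒ (↭⇒∼bag xs↭ys))))
    piece-vanishes : ∀ w → Valid m w → ¬ InterIs w A B → piece f B w ≡ false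
    piece-vanishes w _ ¬w∩A≡B =
      trans (cong (f w ∧_) (dec-false (trace w ≟ᴸ B) (λ t≡B → ¬w∩A≡B (subst (InterIs w A) t≡B (trace-InterIs w)))))
            (∧-zeroʳ (f w))

  pieces : Fn → List (Σ (List ℕ) (λ _ → Fn))
  pieces f = map (λ B → B , piece f B) smallSubsets

  sum-pieces : (f : Fn) (v : List ℕ) → sumF (map proj₂ (pieces f)) v ≡ f v ∧ does (small? (trace v))
  sum-pieces f v = begin
    sumF (map proj₂ (pieces f)) v
      ≡⟨ cong (λ fs → sumF fs v) (sym (map-∘ smallSubsets)) ⟩
    sumF (map (piece f) smallSubsets) v
      ≡⟨ sumF-map≡parity smallSubsets (piece f) v ⟩
    parity smallSubsets (λ B → f v ∧ does (trace v ≟ᴸ B))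
      ≡⟨ parity-∧ˡ (f v) smallSubsets _ ⟩
    f v ∧ parity smallSubsets (λ B → does (trace v ≟ᴸ B))
      ≡⟨ cong (f v ∧_) (parity-≟ (≡-dec _≟_) smallSubsets-unique) ⟩
    f v ∧ does (trace v ∈ᴸ? smallSubsets)
      ≡⟨ cong (f v ∧_) (trace∈smallSubsets v) ⟩
    f v ∧ does (small? (trace v)) ∎
    where open ≡-Reasoning

  corrected≡f∧small : IsSetFun m f → Valid m v →
    (f ⊕ representative (support f)) v ≡ f v ∧ does (small? (trace v))
  corrected≡f∧small {f} {v} f-set v-valid =
    xor-not-∧ (f v) (does (small? (trace v))) _ λ large → begin
      does (trace v ∈ᴸ? support f)
        ≡⟨ trace∈support f v ⟩
      f (trace v)
        ≡⟨ sym (IsSetFun-resp-∼ₛ f-set v-valid (trace-unique v) (trace-large⇒∼ₛ v-valid (¬small large))) ⟩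
      f v ∎
    where
    open ≡-Reasoning
    ¬small : does (small? (trace v)) ≡ false → ¬ length (trace v) < m
    ¬small large small = case trans (sym large) (dec-true (small? (trace v)) small) of λ ()

  VA-finiteIndex : FiniteIndex m (VA m A)
  VA-finiteIndex = map representative (subsets (subsets A!)) ,
    All.map⁺ (All.tabulate λ {S} _ → SetInvariant⇒IsSetFun (representative-invariant S)) ,
    λ f f-set → Any.map⁺ (lose (filter∈subsets (T? ∘ f) (subsets A!)) (corrected∈VA f f-set))
    where
    corrected∈VA : (f : Fn) → IsSetFun m f → VA m A (f ⊕ representative (support f))
    corrected∈VA f f-set =
      IsSetFun-⊕ f-set (SetInvariant⇒IsSetFun (representative-invariant (support f))) ,
      pieces f ,
      All.map⁺ (All.tabulate λ B∈ → ∈-smallSubsets⇒SmallSubset B∈ , piece∈V[B,A] f-set) ,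
      λ v v-valid → trans (corrected≡f∧small f-set v-valid) (sym (sum-pieces f v))

swap : ℕ → ℕ → ℕ → ℕ
swap a b z with z ≟ a | z ≟ b
... | yes _ | _     = b
... | no _  | yes _ = a
... | no _  | no _  = z

swap-left : (a b : ℕ) → swap a b a ≡ b
swap-left a b with a ≟ a
... | yes _ = refl
... | no a≢a = ⊥-elim (a≢a refl)

swap-right : (a b : ℕ) → swap a b b ≡ a
swap-right a b with b ≟ a | b ≟ b
... | yes b≡a | _ = b≡a
... | no _ | yes _ = refl
... | no _ | no b≢b = ⊥-elim (b≢b refl)

swap-fixes : {a b z : ℕ} → z ≢ a → z ≢ b → swap a b z ≡ z
swap-fixes {a} {b} {z} z≢a z≢b with z ≟ a | z ≟ b
... | yes z≡a | _ = ⊥-elim (z≢a z≡a)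
... | no _ | yes z≡b = ⊥-elim (z≢b z≡b)
... | no _ | no _ = refl

swap-involutive : (a b z : ℕ) → swap a b (swap a b z) ≡ z
swap-involutive a b z with z ≟ a | z ≟ b
... | yes refl | _ = swap-right z b
... | no _ | yes refl = swap-left a z
... | no z≢a | no z≢b = swap-fixes z≢a z≢b

transposition : ℕ → ℕ → ℕ ↔ ℕ
transposition a b = mk↔ₛ′ (swap a b) (swap a b) (swap-involutive a b) (swap-involutive a b)

-- InterIs is not decidable, but its double negation suffices for the counting argument.
point-outside : {A B w : List ℕ} → Valid m w → length B < m → ¬ ¬ InterIs w A B → ∃[ x ] (x ∈ w × x ∉ A)
point-outside {A = A} {B} {w} (w! , |w|≡m) B-small ¬¬w∩A≡B with any? (λ x → ¬? (x ∈? A)) w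
... | yes outside = find outside
... | no ¬outside = ⊥-elim (¬¬w∩A≡B λ w∩A≡B →
  <⇒≱ B-small (subst (_≤ length B) |w|≡m (unique∧⊆⇒length≤ w! (w⊆B w∩A≡B))))
  where
  w⊆B : InterIs w A B → w ⊆ B
  w⊆B w∩A≡B z∈w = Equivalence.to (w∩A≡B _) (z∈w , decidable-stable (_ ∈? A) λ z∉A → ¬outside (lose z∈w z∉A))

module SubmodulesOfFiniteIndex {m : ℕ} {A : List ℕ} {V : Fn → Set}
  (V-submodule : IsClosedSubmodule m A V) (V-finiteIndex : FiniteIndex m V) where
  open IsClosedSubmodule V-submodule
  open IsSubgroup subgroup

  V-resp-≈ : V g → IsSetFun m f → f ≈[ m ] g → V f
  V-resp-≈ {g} {f} g∈V f-set f≈g = closed f f-set λ ws ws-valid → g , g∈V , All.map (λ {w} → f≈g w) ws-valid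

  collision : (F : ℕ → Fn) → (∀ k → IsSetFun m (F k)) → ∃[ i ] ∃[ j ] (i ≢ j × V (F i ⊕ F j))
  collision F F-set = toℕ i , toℕ j , <⇒≢ i<j ,
    V-resp-≈ (⊕∈ _ _ Fi⊕r∈V Fj⊕r∈V) (IsSetFun-⊕ (F-set (toℕ i)) (F-set (toℕ j)))
      λ v _ → sym (xor-cancelʳ (F (toℕ i) v) (F (toℕ j) v) (r v))
    where
    reps = proj₁ V-finiteIndex
    coset : ∀ k → Any (λ r → V (F k ⊕ r)) reps
    coset k = proj₂ (proj₂ V-finiteIndex) (F k) (F-set k)
    cosetIndex : Fin (suc (length reps)) → Fin (length reps)
    cosetIndex k = index (coset (toℕ k))
    collide = pigeonhole (n<1+n (length reps)) cosetIndex
    i = proj₁ collide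
    j = proj₁ (proj₂ collide)
    i<j = proj₁ (proj₂ (proj₂ collide))
    r = lookup reps (cosetIndex i)
    Fi⊕r∈V : V (F (toℕ i) ⊕ r)
    Fi⊕r∈V = lookup-index (coset (toℕ i))
    Fj⊕r∈V : V (F (toℕ j) ⊕ r)
    Fj⊕r∈V = subst (λ k → V (F (toℕ j) ⊕ lookup reps k)) (sym (proj₂ (proj₂ (proj₂ collide))))
                   (lookup-index (coset (toℕ j)))

  𝟙⊕𝟙-fresh∈V : {x : ℕ} {w : List ℕ} → x ∈ w → x ∉ A → (N : ℕ) → x ≤ N → All (_≤ N) A →
    ∃[ w′ ] ∃[ y ] (N < y × y ∈ w′ × V (𝟙[ w ] ⊕ 𝟙[ w′ ]))
  𝟙⊕𝟙-fresh∈V {x} {w} x∈w x∉A N x≤N A≤N = moved (collision F (λ k → 𝟙-IsSetFun (map (τ k) w)))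
    where
    fresh : ℕ → ℕ
    fresh k = suc N + k
    N<fresh : ∀ k → N < fresh k
    N<fresh k = s≤s (m≤m+n N k)
    τ : ℕ → ℕ → ℕ
    τ k = swap x (fresh k)
    F : ℕ → Fn
    F k = 𝟙[ map (τ k) w ]
    moved : ∃[ i ] ∃[ j ] (i ≢ j × V (F i ⊕ F j)) → ∃[ w′ ] ∃[ y ] (N < y × y ∈ w′ × V (𝟙[ w ] ⊕ 𝟙[ w′ ]))
    moved (i , j , i≢j , Fi⊕Fj∈V) =
      map (τ i) (map (τ j) w) , fresh j , N<fresh j , fresh-j∈ ,
      V-resp-≈ (invariant (transposition x (fresh i)) τi-fixes-A (F i ⊕ F j) Fi⊕Fj∈V)
               (IsSetFun-⊕ (𝟙-IsSetFun w) (𝟙-IsSetFun _)) λ v _ → untwist v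
      where
      τi-involutive = swap-involutive x (fresh i)
      untwist : ∀ v → (𝟙[ w ] ⊕ 𝟙[ map (τ i) (map (τ j) w) ]) v ≡ act (transposition x (fresh i)) (F i ⊕ F j) v
      untwist v = sym (cong₂ _xor_
        (trans (𝟙-map-involution τi-involutive (map (τ i) w) v)
               (cong (λ w → 𝟙[ w ] v) (map-involutive τi-involutive w)))
        (𝟙-map-involution τi-involutive (map (τ j) w) v))
      τi-fixes-A : FixesPointwise A (transposition x (fresh i))
      τi-fixes-A a a∈A = swap-fixes (λ a≡x → x∉A (subst (_∈ A) a≡x a∈A))
                                    (<⇒≢ (≤-<-trans (All.lookup A≤N a∈A) (N<fresh i)))
      fresh-j∈ : fresh j ∈ map (τ i) (map (τ j) w)
      fresh-j∈ = subst (_∈ map (τ i) (map (τ j) w))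
        (trans (cong (τ i) (swap-left x (fresh j)))
               (swap-fixes (λ fj≡x → <⇒≱ (N<fresh j) (subst (_≤ N) (sym fj≡x) x≤N))
                           (i≢j ∘ sym ∘ +-cancelˡ-≡ (suc N) j i)))
        (∈-map⁺ (τ i) (∈-map⁺ (τ j) x∈w))

  𝟙∈V : {x : ℕ} {w : List ℕ} → x ∈ w → x ∉ A → V 𝟙[ w ]
  𝟙∈V {x} {w} x∈w x∉A = closed 𝟙[ w ] (𝟙-IsSetFun w) λ ws _ → approximation ws
    where
    points : List (List ℕ) → List ℕ
    points ws = x ∷ A ++ concat ws
    bound : List (List ℕ) → ℕ
    bound ws = sum (points ws)
    approximation : ∀ ws → ∃[ g ] (V g × All (λ v → 𝟙[ w ] v ≡ g v) ws)
    approximation ws = agreeing (𝟙⊕𝟙-fresh∈V x∈w x∉A (bound ws) (∈⇒≤sum {zs = points ws} (here refl))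
                                  (All.tabulate λ a∈A → ∈⇒≤sum {zs = points ws} (there (∈-++⁺ˡ a∈A))))
      where
      agreeing : ∃[ w′ ] ∃[ y ] (bound ws < y × y ∈ w′ × V (𝟙[ w ] ⊕ 𝟙[ w′ ])) →
                 ∃[ g ] (V g × All (λ v → 𝟙[ w ] v ≡ g v) ws)
      agreeing (w′ , y , bound<y , y∈w′ , 𝟙⊕𝟙∈V) = 𝟙[ w ] ⊕ 𝟙[ w′ ] , 𝟙⊕𝟙∈V , All.tabulate agrees
        where
        agrees : ∀ {v} → v ∈ ws → 𝟙[ w ] v ≡ (𝟙[ w ] ⊕ 𝟙[ w′ ]) v
        agrees {v} v∈ws = sym (trans (cong (𝟙[ w ] v xor_) (𝟙-separated y∈w′ y∉v)) (xor-identityʳ (𝟙[ w ] v)))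
          where
          y∉v : y ∉ v
          y∉v y∈v = <⇒≱ bound<y (∈⇒≤sum {zs = points ws} (there (∈-++⁺ʳ A (∈-concat⁺′ y∈v v∈ws))))

  -- Built greedily: add 𝟙_w at each listed w where p and the current approximation disagree;
  -- approx⇒p guarantees that such a w always lies in the support of p.
  record Approximant (p : Fn) (ws : List (List ℕ)) : Set where
    field
      approx : Fn
      approx∈V : V approx
      approx-set : IsSetFun m approx
      approx⇒p : ∀ v → Valid m v → approx v ≡ true → p v ≡ true
      agrees : All (λ w → p w ≡ approx w) ws

  approximant : {p : Fn} → IsSetFun m p → (∀ w → Valid m w → p w ≡ true → V 𝟙[ w ]) →
    ∀ ws → All (Valid m) ws → Approximant p ws
  approximant _ _ [] [] = record
    { approx = zeroF ; approx∈V = zero∈ ; approx-set = λ _ _ _ _ → refl ; approx⇒p = λ _ _ () ; agrees = [] }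
  approximant {p} p-set 𝟙w∈V (w ∷ ws) (w-valid ∷ ws-valid) = extend (approximant p-set 𝟙w∈V ws ws-valid)
    where
    module Extend (a : Approximant p ws) where
      open Approximant a

      keep : p w ≡ approx w → Approximant p (w ∷ ws)
      keep agree = record
        { approx = approx ; approx∈V = approx∈V ; approx-set = approx-set ; approx⇒p = approx⇒p
        ; agrees = agree ∷ agrees }

      add : p w ≢ approx w → Approximant p (w ∷ ws)
      add disagree = record
        { approx = approx ⊕ 𝟙[ w ]
        ; approx∈V = ⊕∈ _ _ approx∈V (𝟙w∈V w w-valid pw)
        ; approx-set = IsSetFun-⊕ approx-set (𝟙-IsSetFun w)
        ; approx⇒p = λ v v-valid approx⊕𝟙≡true →
            [ (λ 𝟙≡true → trans (p∼w v-valid 𝟙≡true) pw) , approx⇒p v v-valid ]′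
              (xor-true (approx v) (𝟙[ w ] v) approx⊕𝟙≡true)
        ; agrees = trans pw (sym (cong₂ _xor_ gw (𝟙-self w))) ∷ All.tabulate agrees-rest
        }
        where
        pw : p w ≡ true
        pw = proj₁ (disagreement disagree (approx⇒p w w-valid))
        gw : approx w ≡ false
        gw = proj₂ (disagreement disagree (approx⇒p w w-valid))
        p∼w : ∀ {v} → Valid m v → 𝟙[ w ] v ≡ true → p v ≡ p w
        p∼w v-valid 𝟙≡true = IsSetFun-resp-∼ₛ p-set v-valid (proj₁ w-valid) (𝟙-true⇒∼ₛ 𝟙≡true)
        agrees-rest : ∀ {u} → u ∈ ws → p u ≡ (approx ⊕ 𝟙[ w ]) u
        agrees-rest {u} u∈ws = trans pu≡gu (sym (trans (cong (approx u xor_) 𝟙≡false) (xor-identityʳ (approx u))))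
          where
          u-valid = All.lookup ws-valid u∈ws
          pu≡gu = All.lookup agrees u∈ws
          𝟙≡false : 𝟙[ w ] u ≡ false
          𝟙≡false = dec-false (u ∼ₛ? w) λ u∼w → case
            trans (sym pw) (trans (sym (IsSetFun-resp-∼ₛ p-set u-valid (proj₁ w-valid) u∼w))
              (trans pu≡gu (trans (IsSetFun-resp-∼ₛ approx-set u-valid (proj₁ w-valid) u∼w) gw))) of λ ()

    extend : Approximant p ws → Approximant p (w ∷ ws)
    extend a with p w ≟ᴮ Approximant.approx a w
    ... | yes agree = Extend.keep a agree
    ... | no disagree = Extend.add a disagree

  supported∈V : {p : Fn} → IsSetFun m p → (∀ w → Valid m w → p w ≡ true → V 𝟙[ w ]) → V p
  supported∈V {p} p-set 𝟙w∈V = closed p p-set λ ws ws-valid →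
    let open Approximant (approximant p-set 𝟙w∈V ws ws-valid) in approx , approx∈V , agrees

  V[B,A]⊆V : {B : List ℕ} {p : Fn} → SmallSubset m A B → (V[ B , A ] m) p → V p
  V[B,A]⊆V (_ , _ , B-small) (p-set , p-vanishes) = supported∈V p-set λ w w-valid pw →
    let x , x∈w , x∉A = point-outside w-valid B-small λ ¬w∩A≡B →
          case trans (sym pw) (p-vanishes w w-valid ¬w∩A≡B) of λ ()
    in 𝟙∈V x∈w x∉A

  VA⊆V : VA m A f → V f
  VA⊆V (f-set , parts , parts∈V[B,A] , f≈sum) = V-resp-≈ (sum∈V parts∈V[B,A]) f-set f≈sum
    where
    sum∈V : ∀ {parts} → All (λ p → SmallSubset m A (proj₁ p) × (V[ proj₁ p , A ] m) (proj₂ p)) parts →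
            V (sumF (map proj₂ parts))
    sum∈V [] = zero∈
    sum∈V ((B-small , p∈V[B,A]) ∷ rest) = ⊕∈ _ _ (V[B,A]⊆V B-small p∈V[B,A]) (sum∈V rest)

lemma3p4 : (n : ℕ) → 1 ≤ n → (A : List ℕ) →
    FiniteIndex (n ∸ 1) (VA (n ∸ 1) A) ×
    ((V : Fn → Set) → IsClosedSubmodule (n ∸ 1) A V → FiniteIndex (n ∸ 1) V →
      ∀ f → VA (n ∸ 1) A f → V f)
-- The argument works for every m = n ∸ 1.
lemma3p4 n _ A =
  FiniteIndexOfVA.VA-finiteIndex (n ∸ 1) A ,
  λ V V-submodule V-finiteIndex f → SubmodulesOfFiniteIndex.VA⊆V V-submodule V-finiteIndex
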